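{- Let $G=(V,A)$ be a flow graph with start vertex $s$ and let $T$ be a rooted tree with the parent property. If $(v',w)$ is the non-null derived arc of an arc $(v,w)\in A$, then there is a path in $G$ from $v'$ to $w$ containing only $w$ and descendants of $v'$ in $T$.
   Context: A flow graph is a finite directed graph $G=(V,A)$ with start vertex $s$ such that every vertex is reachable from $s$; there are no arcs entering $s$. For a rooted tree $T$ with vertex set contained in $V$, $t(v)$ denotes the parent of $v$; ancestors and descendants include the vertex itself. $T$ has the parent property if for every arc $(v,w)\in A$, $t(w)$ is an ancestor of $v$ in $T$. For an arc $(v,w)\in A$, its derived arc is null if $w$ is an ancestor of $v$ in $T$, and otherwise is $(v',w)$, where $v'=v$ if $v=t(w)$, and otherwise $v'$ is the sibling of $w$ in $T$ that is an ancestor of $v$. -}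

module Defs where

open import Data.Nat using (ℕ)
open import Data.Fin using (Fin)
open import Data.List using (List; []; _∷_)
open import Data.List.Membership.Propositional using (_∈_; _∉_)
open import Data.List.Relation.Unary.All using (All)
open import Data.Product using (_×_; _,_; ∃)
open import Data.Sum using (_⊎_)
open import Relation.Nullary using (¬_)
open import Relation.Binary.PropositionalEquality using (_≡_; _≢_)

Arcs : ℕ → Set
Arcs n = List (Fin n × Fin n)

data Path {n : ℕ} (A : Arcs n) : Fin n → Fin n → List (Fin n) → Set where
  here : ∀ {x} → Path A x x (x ∷ [])
  step : ∀ {x y z vs} → (x , y) ∈ A → Path A y z vs → Path A x z (x ∷ vs)

record IsFlowGraph {n : ℕ} (A : Arcs n) (s : Fin n) : Set where
  field
    no-entry  : ∀ v → (v , s) ∉ A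
    reachable : ∀ v → ∃ λ vs → Path A s v vs

-- Ancestor relation determined by a vertex set inT, a root and a parent
-- function: AncR inT r t u v means u is an ancestor of v (reflexively).
data AncR {n : ℕ} (inT : Fin n → Set) (r : Fin n) (t : Fin n → Fin n)
     : Fin n → Fin n → Set where
  anc-refl : ∀ {v} → inT v → AncR inT r t v v
  anc-step : ∀ {u v} → inT v → v ≢ r → AncR inT r t u (t v) → AncR inT r t u v

-- A rooted tree whose vertex set (inT) is contained in Fin n, with root
-- 'root' and parent function 'parent' (meaningful on non-root tree vertices).
record RootedTree (n : ℕ) : Set₁ where
  field
    inT      : Fin n → Set
    root     : Fin n
    parent   : Fin n → Fin n
    root∈T   : inT root
    parent∈T : ∀ v → inT v → v ≢ root → inT (parent v)
    -- tree condition: the parent chain of every tree vertex reaches the root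
    rooted   : ∀ v → inT v → AncR inT root parent root v

  Anc : Fin n → Fin n → Set
  Anc = AncR inT root parent

  Sibling : Fin n → Fin n → Set
  Sibling x y = inT x × inT y × x ≢ root × y ≢ root × x ≢ y × parent x ≡ parent y

open RootedTree public

ParentProperty : ∀ {n} → Arcs n → RootedTree n → Set
ParentProperty A T =
  ∀ v w → (v , w) ∈ A →
    inT T w × w ≢ root T × Anc T (parent T w) v

-- NonNullDerivedArc T v w v' : the derived arc of (v,w) w.r.t. T is non-null
-- and equals (v',w).
NonNullDerivedArc : ∀ {n} → RootedTree n → Fin n → Fin n → Fin n → Set
NonNullDerivedArc T v w v' =
  ¬ Anc T w v ×
  ( (v ≡ parent T w × v' ≡ v)
  ⊎ (v ≢ parent T w × Sibling T v' w × Anc T v' v) )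

-- It suffices to
-- find a path from v' to v through descendants of v' only, then append the
-- arc (v,w) (lemma snoc-arc).  If v' = v = t(w) the one-vertex path works.
-- Otherwise v' is an ancestor of v, and we trace a path from the start s to v
-- backwards.  The parent property makes the subtree of v' closed backwards
-- along arcs (arc-source-below): if (x,y) is an arc and y is a descendant of v' other than v'
-- itself, then t(y), an ancestor of x, is a descendant of v', hence so is x.
-- So going backwards from v we stay among descendants of v' until we meet v'
-- itself, which yields the required path (enter-subtree).  We must meet v': otherwise s would
-- be a descendant of v'; but no arc enters the root of T (parent property),
-- so the root, being reachable from s, equals s (root-is-start), and v' would be the root,
-- contradicting that v' is a sibling of w.
module Submission where

open import Defs
open import Data.Nat using (ℕ)
open import Data.Fin using (Fin; _≟_)
open import Data.List using ([]; _∷_)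
open import Data.List.Membership.Propositional using (_∈_)
open import Data.List.Relation.Unary.All using (All; []; _∷_)
open import Data.Product using (_×_; _,_; ∃; proj₁; proj₂)
open import Data.Sum using (_⊎_; inj₁; inj₂)
open import Relation.Binary.PropositionalEquality using (_≡_; refl; sym; _≢_; subst)
open import Relation.Nullary using (yes; no)
open import Data.Empty using (⊥-elim)

module _ {n : ℕ} (T : RootedTree n) where

  anc-trans : ∀ {a b c} → Anc T a b → Anc T b c → Anc T a c
  anc-trans ab (anc-refl _)        = ab
  anc-trans ab (anc-step i ne bc) = anc-step i ne (anc-trans ab bc)

  anc-inT : ∀ {a b} → Anc T a b → inT T a
  anc-inT (anc-refl i)      = i
  anc-inT (anc-step _ _ p) = anc-inT p

  anc-parent : ∀ {a y} → Anc T a y → y ≢ a → Anc T a (parent T y)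
  anc-parent (anc-refl _)      y≢a = ⊥-elim (y≢a refl)
  anc-parent (anc-step _ _ p) _   = p

  anc-of-root : ∀ {a} → Anc T a (root T) → a ≡ root T
  anc-of-root (anc-refl _)        = refl
  anc-of-root (anc-step _ r≢r _) = ⊥-elim (r≢r refl)

path-head : ∀ {n} {A : Arcs n} {P : Fin n → Set} {x z vs} →
            Path A x z vs → All P vs → P x
path-head here       (px ∷ _) = px
path-head (step _ _) (px ∷ _) = px

snoc-arc : ∀ {n} {A : Arcs n} {P : Fin n → Set} {x u w vs} →
           Path A x u vs → All P vs → (u , w) ∈ A →
           ∃ λ ws → Path A x w ws × All (λ z → z ≡ w ⊎ P z) ws
snoc-arc here        (px ∷ [])   uw = _ , step uw here , inj₂ px ∷ inj₁ refl ∷ []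
snoc-arc (step xy p) (px ∷ rest) uw with snoc-arc p rest uw
... | _ , q , ok = _ , step xy q , inj₂ px ∷ ok

arc-into : ∀ {n} {A : Arcs n} {x y z vs} →
           (x , y) ∈ A → Path A y z vs → ∃ λ u → (u , z) ∈ A
arc-into xy here           = _ , xy
arc-into _  (step yy' p) = arc-into yy' p

module _ {n : ℕ} (A : Arcs n) (T : RootedTree n) (pp : ParentProperty A T) where

  InSubtree : Fin n → Fin n → Set
  InSubtree a u = ∃ λ vs → Path A a u vs × All (Anc T a) vs

  arc-source-below : ∀ {a x y} → (x , y) ∈ A → Anc T a y → y ≢ a → Anc T a x
  arc-source-below {x = x} {y} xy ay y≢a =
    anc-trans T (anc-parent T ay y≢a) (proj₂ (proj₂ (pp x y xy)))

  enter-subtree : ∀ a {x u vs} → Path A x u vs → Anc T a u →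
                  InSubtree a u ⊎ All (Anc T a) vs
  enter-subtree a here au = inj₂ (au ∷ [])
  enter-subtree a (step {y = y} xy p) au with enter-subtree a p au
  ... | inj₁ found = inj₁ found
  ... | inj₂ below with y ≟ a
  ...   | yes refl = inj₁ (_ , p , below)
  ...   | no y≢a   = inj₂ (arc-source-below xy (path-head p below) y≢a ∷ below)

  -- No arc enters the root of T, so the root of T is the start vertex.
  root-is-start : ∀ {s} → IsFlowGraph A s → root T ≡ s
  root-is-start {s} fg with IsFlowGraph.reachable fg (root T)
  ... | _ , here        = refl
  ... | _ , step sy p with arc-into sy p
  ...   | u , into-root = ⊥-elim (proj₁ (proj₂ (pp u (root T) into-root)) refl)

  derived-source-reachable : ∀ {s} → IsFlowGraph A s → ∀ {v w v'} →
    (v , w) ∈ A → NonNullDerivedArc T v w v' → InSubtree v' v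
  derived-source-reachable _ {v} {w} vw (_ , inj₁ (v≡tw , refl)) =
    _ , here , anc-refl v∈T ∷ []
    where
    v∈T : inT T v
    v∈T = subst (inT T) (sym v≡tw) (anc-inT T (proj₂ (proj₂ (pp v w vw))))
  derived-source-reachable fg {v} vw (_ , inj₂ (_ , (_ , _ , v'≢r , _) , v'v))
    with IsFlowGraph.reachable fg v
  ... | _ , sv with enter-subtree _ sv v'v
  ...   | inj₁ found = found
  ...   | inj₂ below =
          ⊥-elim (v'≢r (anc-of-root T (subst (Anc T _) (sym (root-is-start fg))
                                                       (path-head sv below))))

lemma14 : (n : ℕ) (A : Arcs n) (s : Fin n) → IsFlowGraph A s →
    (T : RootedTree n) → ParentProperty A T →
    (v w v' : Fin n) → (v , w) ∈ A → NonNullDerivedArc T v w v' →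
    ∃ λ vs → Path A v' w vs × All (λ u → u ≡ w ⊎ Anc T v' u) vs
lemma14 n A s fg T pp v w v' vw derived
  with derived-source-reachable A T pp fg vw derived
... | _ , v'v , below = snoc-arc v'v below vw
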